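{- Let $I=(E,\mathcal{I},c,T)$ be an EMB instance, let $P\in\mathcal{Q}$, and let $S$ be a solution for $R_P(I)$ satisfying $v_I(S)=k_I\cdot H_I+T$. Then $S$ is a solution for $I$.
   Context: A matroid is a pair $(E,\mathcal{I})$ with $E$ finite, $\emptyset\in\mathcal{I}\subseteq2^E$, closed under subsets, with the exchange property; for $\mathcal{M}=(E,\mathcal{I})$, $\mathrm{IS}(\mathcal{M})=\mathcal{I}$ and $\mathrm{bases}(\mathcal{M})$ is the set of independent sets of maximum cardinality. For a function $f$ on $E$ and $Y\subseteq E$, $f(Y)=\sum_{e\in Y}f(e)$. EMB instance: $(E,\mathcal{I},c,T)$ with $(E,\mathcal{I})$ a matroid, $c:E\to\mathbb{N}$, $T\in\mathbb{N}$; a solution is a basis $S$ with $c(S)=T$. $\mathcal{Q}=\left(\{\max,\min\}\times\{\mathrm{bases},\mathrm{IS}\}\times\{\le,\ge\}\right)\setminus\{(\min,\mathrm{IS},\le)\}$. For $P=(\mathrm{opt},\mathcal{F},\triangleleft)$, a $P$-MOL instance $(E,\mathcal{I},v,w,L)$ (matroid $\mathcal{M}=(E,\mathcal{I})$, $v,w:E\to\mathbb{R}_{\ge0}$, $L\ge0$) has as solutions the sets $S\in\mathcal{F}(\mathcal{M})$ with $w(S)\triangleleft L$. Reduction: $d(P)=0$ if ($\mathrm{opt}=\max$ and $\triangleleft$ is $\le$) or ($\mathrm{opt}=\min$ and $\triangleleft$ is $\ge$), else $d(P)=1$; $H_I=2\max\{1,c(E)\}$; $v_I(e)=H_I+c(e)$;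 $w_{I,P}(e)=H_I+c(e)(-1)^{d(P)}$; $k_I=\max_{S\in\mathcal{I}}|S|$; $L_{I,P}=k_IH_I+T(-1)^{d(P)}$; $R_P(I)=(E,\mathcal{I},v_I,w_{I,P},L_{I,P})$. -}

module Defs where

open import Data.Nat as ℕ using (ℕ; _<_; _≤_)
open import Data.Integer as ℤ using (ℤ; +_; -1ℤ)
open import Data.Bool using (Bool; true; false)
open import Data.Fin using (Fin; zero; suc)
open import Data.Fin.Subset using (Subset; _∈_; _∉_; _⊆_; _∪_; ⁅_⁆; ∣_∣; ⊥; ⊤)
open import Data.Vec using ([]; _∷_)
open import Data.Product using (Σ; _×_; ∃)
open import Relation.Binary.PropositionalEquality using (_≡_)
open import Relation.Nullary using (¬_)

sumℕ : ∀ {n} → (Fin n → ℕ) → Subset n → ℕ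
sumℕ f [] = 0
sumℕ f (true ∷ s) = f zero ℕ.+ sumℕ (λ i → f (suc i)) s
sumℕ f (false ∷ s) = sumℕ (λ i → f (suc i)) s

sumℤ : ∀ {n} → (Fin n → ℤ) → Subset n → ℤ
sumℤ f [] = + 0
sumℤ f (true ∷ s) = f zero ℤ.+ sumℤ (λ i → f (suc i)) s
sumℤ f (false ∷ s) = sumℤ (λ i → f (suc i)) s

record Matroid (n : ℕ) : Set₁ where
  field
    Indep      : Subset n → Set
    indep-∅    : Indep ⊥
    indep-⊆    : ∀ {A B} → A ⊆ B → Indep B → Indep A
    exchange   : ∀ {A B} → Indep A → Indep B → ∣ A ∣ < ∣ B ∣ →
                 Σ (Fin n) λ e → e ∈ B × e ∉ A × Indep (A ∪ ⁅ e ⁆)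
open Matroid public

IsMaxIndepSize : ∀ {n} → Matroid n → ℕ → Set
IsMaxIndepSize {n} M k = (Σ (Subset n) λ S → Indep M S × ∣ S ∣ ≡ k) × (∀ S → Indep M S → ∣ S ∣ ≤ k)

IsBasis : ∀ {n} → Matroid n → Subset n → Set
IsBasis M S = Indep M S × (∀ S' → Indep M S' → ∣ S' ∣ ≤ ∣ S ∣)

record EMB (n : ℕ) : Set₁ where
  field
    mat : Matroid n
    c   : Fin n → ℕ
    T   : ℕ
open EMB public

IsEMBSolution : ∀ {n} → EMB n → Subset n → Set
IsEMBSolution I S = IsBasis (mat I) S × sumℕ (c I) S ≡ T I

data Opt : Set where
  max min : Opt
data Fam : Set where
  bases IS : Fam
data Rel : Set where
  le ge : Rel

record Variant : Set where
  constructor var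
  field
    opt : Opt
    fam : Fam
    rel : Rel
open Variant public

InQ : Variant → Set
InQ P = ¬ (P ≡ var min IS le)

InFam : ∀ {n} → Fam → Matroid n → Subset n → Set
InFam bases M S = IsBasis M S
InFam IS    M S = Indep M S

relℤ : Rel → ℤ → ℤ → Set
relℤ le x y = x ℤ.≤ y
relℤ ge x y = x ℤ.≥ y

d : Variant → ℕ
d (var max _ le) = 0
d (var min _ ge) = 0
d (var max _ ge) = 1
d (var min _ le) = 1

-- Reduction quantities (all values are integers, so ℤ/ℕ suffice)
H : ∀ {n} → EMB n → ℕ
H I = 2 ℕ.* (1 ℕ.⊔ sumℕ (c I) ⊤)

vI : ∀ {n} → EMB n → Fin n → ℕ
vI I e = H I ℕ.+ c I e

wIP : ∀ {n} → EMB n → Variant → Fin n → ℤ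
wIP I P e = + H I ℤ.+ (+ c I e) ℤ.* (-1ℤ ℤ.^ d P)

-- L_{I,P}, with k = k_I supplied
LIP : ∀ {n} → EMB n → Variant → ℕ → ℤ
LIP I P k = + (k ℕ.* H I) ℤ.+ (+ T I) ℤ.* (-1ℤ ℤ.^ d P)

-- S is a solution of the P-MOL instance R_P(I) = (E, I, v_I, w_{I,P}, L_{I,P})
IsRSolution : ∀ {n} → EMB n → Variant → ℕ → Subset n → Set
IsRSolution I P k S = InFam (fam P) (mat I) S × relℤ (rel P) (sumℤ (wIP I P) S) (LIP I P k)

-- v_I(S) = |S|·H_I + c(S), and c(S) ≤ c(E) < H_I while |S| ≤ k_I. Read in
-- base H_I, the equation v_I(S) = k_I·H_I + T therefore forces |S| = k_I, so S
-- is a basis, and c(S) = T.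
module Submission where

open import Defs
open import Data.Nat using (ℕ; suc; _+_; _*_; _≤_; _<_; _⊔_)
open import Data.Nat.Properties
open import Data.Fin using (Fin; zero; suc)
open import Data.Fin.Subset using (Subset; ∣_∣; ⊤)
open import Data.Bool using (true; false)
open import Data.Vec using ([]; _∷_)
open import Data.Product using (_,_)
open import Data.Sum using (inj₁; inj₂)
open import Relation.Nullary using (contradiction)
open import Relation.Binary.PropositionalEquality using (_≡_; refl; sym; trans; cong; subst)
open import Algebra.Properties.CommutativeSemigroup +-commutativeSemigroup using (interchange)

sumℕ-const : ∀ {n} (h : ℕ) (S : Subset n) → sumℕ (λ _ → h) S ≡ ∣ S ∣ * h
sumℕ-const h []          = refl
sumℕ-const h (true ∷ S)  = cong (h +_) (sumℕ-const h S)
sumℕ-const h (false ∷ S) = sumℕ-const h S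

sumℕ-+ : ∀ {n} (f g : Fin n → ℕ) (S : Subset n) →
         sumℕ (λ e → f e + g e) S ≡ sumℕ f S + sumℕ g S
sumℕ-+ f g []          = refl
sumℕ-+ f g (true ∷ S)  =
  trans (cong (f zero + g zero +_) (sumℕ-+ (λ i → f (suc i)) (λ i → g (suc i)) S))
        (interchange (f zero) (g zero) _ _)
sumℕ-+ f g (false ∷ S) = sumℕ-+ (λ i → f (suc i)) (λ i → g (suc i)) S

sumℕ≤sumℕ-⊤ : ∀ {n} (f : Fin n → ℕ) (S : Subset n) → sumℕ f S ≤ sumℕ f ⊤
sumℕ≤sumℕ-⊤ f []          = ≤-refl
sumℕ≤sumℕ-⊤ f (true ∷ S)  = +-monoʳ-≤ (f zero) (sumℕ≤sumℕ-⊤ (λ i → f (suc i)) S)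
sumℕ≤sumℕ-⊤ f (false ∷ S) = ≤-trans (sumℕ≤sumℕ-⊤ (λ i → f (suc i)) S) (m≤n+m _ (f zero))

m≤k∧c<h∧m*h+c≡k*h+t⇒m≡k : ∀ {m k h c} t → m ≤ k → c < h → m * h + c ≡ k * h + t → m ≡ k
m≤k∧c<h∧m*h+c≡k*h+t⇒m≡k {m} {k} {h} {c} t m≤k c<h eq with m≤n⇒m<n∨m≡n m≤k
... | inj₂ m≡k = m≡k
... | inj₁ m<k = contradiction eq (<⇒≢ (begin-strict
  m * h + c   <⟨ +-monoʳ-< (m * h) c<h ⟩
  m * h + h   ≡⟨ +-comm (m * h) h ⟩
  suc m * h   ≤⟨ *-monoˡ-≤ h m<k ⟩
  k * h       ≤⟨ m≤m+n (k * h) t ⟩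
  k * h + t   ∎))
  where open ≤-Reasoning

vI-sum : ∀ {n} (I : EMB n) (S : Subset n) → sumℕ (vI I) S ≡ ∣ S ∣ * H I + sumℕ (c I) S
vI-sum I S = trans (sumℕ-+ (λ _ → H I) (c I) S) (cong (_+ sumℕ (c I) S) (sumℕ-const (H I) S))

sumℕ-c<H : ∀ {n} (I : EMB n) (S : Subset n) → sumℕ (c I) S < H I
sumℕ-c<H I S = ≤-<-trans (sumℕ≤sumℕ-⊤ (c I) S) (begin-strict
  cE          ≤⟨ m≤n⊔m 1 cE ⟩
  1 ⊔ cE      <⟨ m<m+n (1 ⊔ cE) (≤-trans (m≤m⊔n 1 cE) (m≤m+n _ _)) ⟩
  H I         ∎)
  where open ≤-Reasoning; cE = sumℕ (c I) ⊤

InFam⇒Indep : ∀ {n} (F : Fam) {M : Matroid n} {S : Subset n} → InFam F M S → Indep M S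
InFam⇒Indep bases (indep , _) = indep
InFam⇒Indep IS    indep       = indep

maxSize⇒basis : ∀ {n} {M : Matroid n} {k : ℕ} {S : Subset n} →
                IsMaxIndepSize M k → Indep M S → ∣ S ∣ ≡ k → IsBasis M S
maxSize⇒basis (_ , maxk) indep refl = indep , maxk

lemma3p3 : ∀ {n} (I : EMB n) (P : Variant) → InQ P →
             (k : ℕ) → IsMaxIndepSize (mat I) k →
             (S : Subset n) → IsRSolution I P k S →
             sumℕ (vI I) S ≡ k * H I + T I →
             IsEMBSolution I S
lemma3p3 I P _ k maxSize@(_ , maxk) S (inFam , _) vS≡ =
  maxSize⇒basis {M = mat I} maxSize indep ∣S∣≡k , +-cancelˡ-≡ (k * H I) _ _ expansion-at-k
  where
  indep : Indep (mat I) S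
  indep = InFam⇒Indep (fam P) inFam
  expansion : ∣ S ∣ * H I + sumℕ (c I) S ≡ k * H I + T I
  expansion = trans (sym (vI-sum I S)) vS≡
  ∣S∣≡k : ∣ S ∣ ≡ k
  ∣S∣≡k = m≤k∧c<h∧m*h+c≡k*h+t⇒m≡k (T I) (maxk S indep) (sumℕ-c<H I S) expansion
  expansion-at-k : k * H I + sumℕ (c I) S ≡ k * H I + T I
  expansion-at-k = subst (λ m → m * H I + sumℕ (c I) S ≡ k * H I + T I) ∣S∣≡k expansion
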